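{- In the theory of exceptions $T_{exc}$, for every propagator $a^{(1)}:X\to Y$, either there is a pure term $u^{(0)}:X\to Y$ such that $a\equiv u$, or there is a pure term $u^{(0)}:X\to P$ such that $a\equiv \mathtt{throw}_Y\circ u$.
   Context: Monadic equational logic $L_{eqn}$ (with empty type): types and terms generated by a signature of unary operations, terms being composable paths $u_k\circ\dots\circ u_1:X_0\to X_k$ (with $\mathrm{id}_X$ for $k=0$); there is an empty type $\mathbb{0}$ with a term $[\,]_Y:\mathbb{0}\to Y$ for each type $Y$. Formulas are pairs of parallel terms, theorems are equations $f\equiv g$. Rules: $\equiv$ is reflexive, symmetric, transitive; (subs) from $u:X\to Y$ and $v_1\equiv v_2:Y\to Z$ infer $v_1\circ u\equiv v_2\circ u$; (repl) from $v_1\equiv v_2:X\to Y$ and $w:Y\to Z$ infer $w\circ v_1\equiv w\circ v_2$; (initial) every $u:\mathbb{0}\to Y$ satisfies $u\equiv[\,]_Y$. Decorated logic for exceptions $L_{exc}$: its pure part is $L_{eqn}$ with a distinguished type $P$; terms of $L_{eqn}$ are pure (decoration $(0)$). Additional terms, all propagators (decoration $(1)$): $\mathtt{throw}_Y^{(1)}:P\to Y$ for each type $Y$; $(\mathtt{try}(a)\mathtt{catch}(b))^{(1)}:X\to Y$ for each propagators $a:X\to Y$, $b:P\to Y$; composites $(a_k\circ\dots\circ a_1)$ whose decoration is the maximum of the decorations of the $a_i$; every pure term is also regarded as a propagator. Formulas are equations $f\equiv g$ between parallel terms. Rules: (equiv), (subs), (repl) for all terms; (initial$_1$) every propagator $a:\mathbb{0}\to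 Y$ satisfies $a\equiv[\,]_Y$; (recover) for pure $u_1,u_2:X\to P$, from $\mathtt{throw}_Y\circ u_1\equiv\mathtt{throw}_Y\circ u_2$ infer $u_1\equiv u_2$; (propagate) for every propagator $a:X\to Y$, $a\circ\mathtt{throw}_X\equiv\mathtt{throw}_Y$; (try) from $a_1\equiv a_2:X\to Y$ and $b:P\to Y$ infer $\mathtt{try}(a_1)\mathtt{catch}(b)\equiv\mathtt{try}(a_2)\mathtt{catch}(b)$; (try$_0$) for pure $u:X\to Y$ and $b:P\to Y$, $\mathtt{try}(u)\mathtt{catch}(b)\equiv u$; (try$_1$) for pure $u:X\to P$ and $b:P\to Y$, $\mathtt{try}(\mathtt{throw}_Y\circ u)\mathtt{catch}(b)\equiv b\circ u$. The theory of exceptions $T_{exc}$ is the theory of $L_{exc}$ (set of equations closed under these rules) generated by some fixed consistent theory $T_{eqn}$ of $L_{eqn}$. "$a\equiv u$" means that this equation belongs to $T_{exc}$. -}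

module Defs where

open import Data.Product using (Σ; ∃; _×_; _,_)
open import Relation.Nullary using (¬_)

record Sig : Set₁ where
  field
    Sort : Set
    Op   : Sort → Sort → Set

module Syntax (S : Sig) where
  open Sig S

  data Ty : Set where
    sort : Sort → Ty
    𝟘    : Ty

  data PAtom : Ty → Ty → Set where
    op    : ∀ {A B} → Op A B → PAtom (sort A) (sort B)
    empty : ∀ Y → PAtom 𝟘 Y

  infixr 6 _·_
  data Pure : Ty → Ty → Set where
    idP : ∀ {X} → Pure X X
    _·_ : ∀ {X Y Z} → PAtom Y Z → Pure X Y → Pure X Z

  infixr 5 _∘ₚ_
  _∘ₚ_ : ∀ {X Y Z} → Pure Y Z → Pure X Y → Pure X Z
  idP ∘ₚ f = f
  (a · g) ∘ₚ f = a · (g ∘ₚ f)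

  []ₚ : ∀ Y → Pure 𝟘 Y
  []ₚ Y = empty Y · idP

  Axioms : Set₁
  Axioms = ∀ {X Y} → Pure X Y → Pure X Y → Set

  data EqnThm (E : Axioms) : ∀ {X Y} → Pure X Y → Pure X Y → Set where
    ax      : ∀ {X Y} {f g : Pure X Y} → E f g → EqnThm E f g
    refl≡   : ∀ {X Y} (f : Pure X Y) → EqnThm E f f
    sym≡    : ∀ {X Y} {f g : Pure X Y} → EqnThm E f g → EqnThm E g f
    trans≡  : ∀ {X Y} {f g h : Pure X Y} → EqnThm E f g → EqnThm E g h → EqnThm E f h
    subs    : ∀ {X Y Z} (u : Pure X Y) {v₁ v₂ : Pure Y Z} →
              EqnThm E v₁ v₂ → EqnThm E (v₁ ∘ₚ u) (v₂ ∘ₚ u)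
    repl    : ∀ {X Y Z} {v₁ v₂ : Pure X Y} (w : Pure Y Z) →
              EqnThm E v₁ v₂ → EqnThm E (w ∘ₚ v₁) (w ∘ₚ v₂)
    initial : ∀ {Y} (u : Pure 𝟘 Y) → EqnThm E u ([]ₚ Y)

  Consistent : Axioms → Set
  Consistent E = Σ Ty λ X → Σ Ty λ Y → Σ (Pure X Y) λ f → Σ (Pure X Y) λ g →
                 ¬ EqnThm E f g

  module Exceptions (P : Ty) where

    mutual
      data Atom : Ty → Ty → Set where
        pure      : ∀ {X Y} → PAtom X Y → Atom X Y
        throw     : ∀ Y → Atom P Y
        try_catch_ : ∀ {X Y} → Term X Y → Term P Y → Atom X Y

      data Term : Ty → Ty → Set where
        id  : ∀ {X} → Term X X
        _⨾_ : ∀ {X Y Z} → Atom Y Z → Term X Y → Term X Z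

    infixr 6 _⨾_
    infixr 5 _∘_
    _∘_ : ∀ {X Y Z} → Term Y Z → Term X Y → Term X Z
    id ∘ f = f
    (a ⨾ g) ∘ f = a ⨾ (g ∘ f)

    ⌜_⌝ : ∀ {X Y} → Pure X Y → Term X Y
    ⌜ idP ⌝ = id
    ⌜ a · f ⌝ = pure a ⨾ ⌜ f ⌝

    throwT : ∀ Y → Term P Y
    throwT Y = throw Y ⨾ id

    tryT : ∀ {X Y} → Term X Y → Term P Y → Term X Y
    tryT a b = (try a catch b) ⨾ id

    data Thm (E : Axioms) : ∀ {X Y} → Term X Y → Term X Y → Set where
      eqn       : ∀ {X Y} {f g : Pure X Y} → EqnThm E f g → Thm E ⌜ f ⌝ ⌜ g ⌝
      refl≡     : ∀ {X Y} (a : Term X Y) → Thm E a a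
      sym≡      : ∀ {X Y} {a b : Term X Y} → Thm E a b → Thm E b a
      trans≡    : ∀ {X Y} {a b c : Term X Y} → Thm E a b → Thm E b c → Thm E a c
      subs      : ∀ {X Y Z} (u : Term X Y) {v₁ v₂ : Term Y Z} →
                  Thm E v₁ v₂ → Thm E (v₁ ∘ u) (v₂ ∘ u)
      repl      : ∀ {X Y Z} {v₁ v₂ : Term X Y} (w : Term Y Z) →
                  Thm E v₁ v₂ → Thm E (w ∘ v₁) (w ∘ v₂)
      initial₁  : ∀ {Y} (a : Term 𝟘 Y) → Thm E a ⌜ []ₚ Y ⌝
      recover   : ∀ {X Y} (u₁ u₂ : Pure X P) →
                  Thm E (throwT Y ∘ ⌜ u₁ ⌝) (throwT Y ∘ ⌜ u₂ ⌝) → Thm E ⌜ u₁ ⌝ ⌜ u₂ ⌝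
      propagate : ∀ {X Y} (a : Term X Y) → Thm E (a ∘ throwT X) (throwT Y)
      try≡      : ∀ {X Y} {a₁ a₂ : Term X Y} (b : Term P Y) →
                  Thm E a₁ a₂ → Thm E (tryT a₁ b) (tryT a₂ b)
      try₀      : ∀ {X Y} (u : Pure X Y) (b : Term P Y) → Thm E (tryT ⌜ u ⌝ b) ⌜ u ⌝
      try₁      : ∀ {X Y} (u : Pure X P) (b : Term P Y) →
                  Thm E (tryT (throwT Y ∘ ⌜ u ⌝) b) (b ∘ ⌜ u ⌝)

-- By structural induction on terms, every propagator is provably equal either
-- to a pure term or to a pure term followed by throw. Composition preserves
-- this shape because a thrown exception passes through any propagator
-- (propagate), and try(a)catch(b) is resolved by the two shapes of a: a pure
-- a is left unchanged (try₀), while a = throw ∘ v turns into b ∘ v (try₁).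
module Submission where

open import Defs
open import Data.Product using (Σ; _,_)
open import Data.Sum using (_⊎_; inj₁; inj₂)
open import Relation.Binary.PropositionalEquality as ≡ using (_≡_; refl; cong)

module _ {S : Sig} {P : Syntax.Ty S} where
  open Syntax S
  open Exceptions P

  ∘-assoc : ∀ {W X Y Z} (a : Term Y Z) (b : Term X Y) (c : Term W X) →
            (a ∘ b) ∘ c ≡ a ∘ (b ∘ c)
  ∘-assoc id      b c = refl
  ∘-assoc (x ⨾ a) b c = cong (x ⨾_) (∘-assoc a b c)

  ⌜⌝-∘ : ∀ {X Y Z} (f : Pure Y Z) (g : Pure X Y) → ⌜ f ∘ₚ g ⌝ ≡ ⌜ f ⌝ ∘ ⌜ g ⌝
  ⌜⌝-∘ idP     g = refl
  ⌜⌝-∘ (x · f) g = cong (pure x ⨾_) (⌜⌝-∘ f g)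

module _ {S : Sig} {P : Syntax.Ty S} {E : Syntax.Axioms S} where
  open Syntax S
  open Exceptions P

  ≡⇒Thm : ∀ {X Y} {a b : Term X Y} → a ≡ b → Thm E a b
  ≡⇒Thm {a = a} refl = refl≡ a

  PureOrThrow : ∀ {X Y} → Term X Y → Set
  PureOrThrow {X} {Y} a = Σ (Pure X Y) (λ u → Thm E a ⌜ u ⌝)
                        ⊎ Σ (Pure X P) (λ u → Thm E a (throwT Y ∘ ⌜ u ⌝))

  PureOrThrow-resp : ∀ {X Y} {a b : Term X Y} →
                     Thm E a b → PureOrThrow b → PureOrThrow a
  PureOrThrow-resp a≡b (inj₁ (u , b≡u)) = inj₁ (u , trans≡ a≡b b≡u)
  PureOrThrow-resp a≡b (inj₂ (u , b≡u)) = inj₂ (u , trans≡ a≡b b≡u)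

  PureOrThrow-∘⌜⌝ : ∀ {X Y Z} {t : Term Y Z} →
                    PureOrThrow t → (u : Pure X Y) → PureOrThrow (t ∘ ⌜ u ⌝)
  PureOrThrow-∘⌜⌝ (inj₁ (w , t≡w)) u =
    inj₁ (w ∘ₚ u , trans≡ (subs ⌜ u ⌝ t≡w) (≡⇒Thm (≡.sym (⌜⌝-∘ w u))))
  PureOrThrow-∘⌜⌝ {Z = Z} (inj₂ (w , t≡w)) u =
    inj₂ (w ∘ₚ u , trans≡ (subs ⌜ u ⌝ t≡w) (≡⇒Thm (begin
      (throwT Z ∘ ⌜ w ⌝) ∘ ⌜ u ⌝  ≡⟨ ∘-assoc (throwT Z) ⌜ w ⌝ ⌜ u ⌝ ⟩
      throwT Z ∘ ⌜ w ⌝ ∘ ⌜ u ⌝    ≡⟨ cong (throwT Z ∘_) (≡.sym (⌜⌝-∘ w u)) ⟩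
      throwT Z ∘ ⌜ w ∘ₚ u ⌝       ∎)))
    where open ≡.≡-Reasoning

  throw-absorbs : ∀ {X Y Z} (t : Term Y Z) (u : Pure X P) →
                  Thm E (t ∘ throwT Y ∘ ⌜ u ⌝) (throwT Z ∘ ⌜ u ⌝)
  throw-absorbs {Y = Y} t u =
    trans≡ (≡⇒Thm (≡.sym (∘-assoc t (throwT Y) ⌜ u ⌝))) (subs ⌜ u ⌝ (propagate t))

  mutual
    pureOrThrow : ∀ {X Y} (t : Term X Y) → PureOrThrow t
    pureOrThrow id = inj₁ (idP , refl≡ id)
    pureOrThrow (A ⨾ g) with pureOrThrow g
    ... | inj₁ (u , g≡u) =
      PureOrThrow-resp (repl (A ⨾ id) g≡u) (PureOrThrow-∘⌜⌝ (pureOrThrow-atom A) u)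
    ... | inj₂ (u , g≡u) =
      inj₂ (u , trans≡ (repl (A ⨾ id) g≡u) (throw-absorbs (A ⨾ id) u))

    pureOrThrow-atom : ∀ {X Y} (A : Atom X Y) → PureOrThrow (A ⨾ id)
    pureOrThrow-atom (pure x)  = inj₁ (x · idP , refl≡ _)
    pureOrThrow-atom (throw Y) = inj₂ (idP , refl≡ _)
    pureOrThrow-atom (try b catch c) with pureOrThrow b
    ... | inj₁ (v , b≡v) = inj₁ (v , trans≡ (try≡ c b≡v) (try₀ v c))
    ... | inj₂ (v , b≡v) =
      PureOrThrow-resp (trans≡ (try≡ c b≡v) (try₁ v c)) (PureOrThrow-∘⌜⌝ (pureOrThrow c) v)

proposition3p2 : (S : Sig) (P : Syntax.Ty S) (E : Syntax.Axioms S) →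
    Syntax.Consistent S E →
    let open Syntax S in let open Exceptions P in
    ∀ {X Y} (a : Term X Y) →
      Σ (Pure X Y) (λ u → Thm E a ⌜ u ⌝)
      ⊎ Σ (Pure X P) (λ u → Thm E a (throwT Y ∘ ⌜ u ⌝))
proposition3p2 S P E _ = pureOrThrow
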